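{- For pure types $A_1,\dots,A_n,B$: the sequent $A_1^{\oplus},\dots,A_n^{\oplus}\vdash B^{\oplus}$ holds in $\lambda^{\mathrm{PRJ}}$ (i.e. there is a term $t$ with $x_1:A_1^{\oplus},\dots,x_n:A_n^{\oplus}\vdash_{\mathrm{PRJ}} t:B^{\oplus}$) if and only if $A_1,\dots,A_n\vdash B$ is derivable in the intuitionistic second-order natural deduction system $\mathrm{NJ}$.
   Context: Pure types: given a denumerable set of type variables $\alpha,\beta,\dots$, pure types are $A,B ::= \alpha \mid A\wedge B \mid A\vee B \mid A\to B \mid A\ltimes B \mid \neg A \mid \forall\alpha.A \mid \exists\alpha.A$ (quantifiers bind $\alpha$; $A[\alpha:=B]$ capture-avoiding substitution; $\mathrm{ftv}$ free type variables). Types are $P,Q ::= A^{+}\mid A^{ - }\mid A^{\oplus}\mid A^{\ominus}$ (modes only at the root); $A^{+},A^{ - }$ strong, $A^{\oplus},A^{\ominus}$ weak; $B^{\oplus}[\alpha:=A]$ means $(B[\alpha:=A])^{\oplus}$, etc. Terms ($\varepsilon\in\{+,-\}$, $i\in\{1,2\}$): $t,s,u ::= x \mid t \mathbin{\#}^{P} s \mid \lambda^{\varepsilon}_{\circ}(x:P).t \mid t \circ^{\varepsilon} s \mid \langle t,s\rangle^{\varepsilon} \mid \pi^{\varepsilon}_i(t) \mid \mathrm{in}^{\varepsilon}_i(t) \mid \mathrm{case}^{\varepsilon}\, t\,[x:P.\,s \mid y:Q.\,u] \mid \lambda^{\varepsilon}(x:P).t \mid t @^{\varepsilon} s \mid \langle\!\langle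 t,s\rangle\!\rangle^{\varepsilon} \mid \mathrm{colam}^{\varepsilon}\, t\,[x:P,y:Q.\,s] \mid \neg\mathrm{I}^{\varepsilon}(t) \mid \neg\mathrm{E}^{\varepsilon}(t) \mid \Lambda^{\varepsilon}\alpha.t \mid t[A]^{\varepsilon} \mid \langle A,t\rangle^{\varepsilon} \mid \mathrm{open}^{\varepsilon}\, t \text{ as } (\alpha,x:P) \text{ in } s$, with evident binders, up to $\alpha$-renaming. A typing context $\Gamma$ is a finite assignment $x_1:P_1,\dots,x_n:P_n$. Typing judgments $\Gamma\vdash t:P$ of $\lambda^{\mathrm{PRK}}$ are derived by the rules: (Ax) $\Gamma,x:P\vdash x:P$. (Abs) if $\Gamma\vdash t:A^{+}$ and $\Gamma\vdash s:A^{ - }$ then $\Gamma\vdash t\mathbin{\#}^{P}s:P$ for any $P$. (Weak) if $\Gamma,x:A^{\ominus}\vdash t:A^{+}$ then $\Gamma\vdash\lambda^{+}_{\circ}(x:A^{\ominus}).t:A^{\oplus}$; if $\Gamma,x:A^{\oplus}\vdash t:A^{ - }$ then $\Gamma\vdash\lambda^{ - }_{\circ}(x:A^{\oplus}).t:A^{\ominus}$; if $\Gamma\vdash t:A^{\oplus}$, $\Gamma\vdash s:A^{\ominus}$ then $\Gamma\vdash t\circ^{+}s:A^{+}$; if $\Gamma\vdash t:A^{\ominus}$, $\Gamma\vdash s:A^{\oplus}$ then $\Gamma\vdash t\circ^{ - }s:A^{ - }$. (Pairs) from $t:A^{\oplus}$, $s:B^{\oplus}$ infer $\langle t,s\rangle^{+}:(A\wedge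 B)^{+}$; from $t:A^{\ominus}$, $s:B^{\ominus}$ infer $\langle t,s\rangle^{ - }:(A\vee B)^{ - }$; from $t:(A_1\wedge A_2)^{+}$ infer $\pi^{+}_i(t):A_i^{\oplus}$; from $t:(A_1\vee A_2)^{ - }$ infer $\pi^{ - }_i(t):A_i^{\ominus}$ (same $\Gamma$ throughout). (Injections) from $t:A_i^{\oplus}$ infer $\mathrm{in}^{+}_i(t):(A_1\vee A_2)^{+}$; from $t:A_i^{\ominus}$ infer $\mathrm{in}^{ - }_i(t):(A_1\wedge A_2)^{ - }$; if $\Gamma\vdash t:(A\vee B)^{+}$, $\Gamma,x:A^{\oplus}\vdash s:P$, $\Gamma,y:B^{\oplus}\vdash u:P$ then $\Gamma\vdash\mathrm{case}^{+}t[x:A^{\oplus}.s\mid y:B^{\oplus}.u]:P$; if $\Gamma\vdash t:(A\wedge B)^{ - }$, $\Gamma,x:A^{\ominus}\vdash s:P$, $\Gamma,y:B^{\ominus}\vdash u:P$ then $\Gamma\vdash\mathrm{case}^{ - }t[x:A^{\ominus}.s\mid y:B^{\ominus}.u]:P$. (Implication/co-implication) if $\Gamma,x:A^{\oplus}\vdash t:B^{\oplus}$ then $\Gamma\vdash\lambda^{+}(x:A^{\oplus}).t:(A\to B)^{+}$; if $\Gamma,x:A^{\ominus}\vdash t:B^{\ominus}$ then $\Gamma\vdash\lambda^{ - }(x:A^{\ominus}).t:(A\ltimes B)^{ - }$; from $t:(A\to B)^{+}$, $s:A^{\oplus}$ infer $t@^{+}s:B^{\oplus}$; from $t:(A\ltimes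 B)^{ - }$, $s:A^{\ominus}$ infer $t@^{ - }s:B^{\ominus}$; from $t:A^{\ominus}$, $s:B^{\oplus}$ infer $\langle\!\langle t,s\rangle\!\rangle^{+}:(A\ltimes B)^{+}$; from $t:A^{\oplus}$, $s:B^{\ominus}$ infer $\langle\!\langle t,s\rangle\!\rangle^{ - }:(A\to B)^{ - }$; if $\Gamma\vdash t:(A\ltimes B)^{+}$ and $\Gamma,x:A^{\ominus},y:B^{\oplus}\vdash s:P$ then $\Gamma\vdash\mathrm{colam}^{+}t[x:A^{\ominus},y:B^{\oplus}.s]:P$; if $\Gamma\vdash t:(A\to B)^{ - }$ and $\Gamma,x:A^{\oplus},y:B^{\ominus}\vdash s:P$ then $\Gamma\vdash\mathrm{colam}^{ - }t[x:A^{\oplus},y:B^{\ominus}.s]:P$. (Negation) from $t:A^{\ominus}$ infer $\neg\mathrm{I}^{+}(t):(\neg A)^{+}$; from $t:A^{\oplus}$ infer $\neg\mathrm{I}^{ - }(t):(\neg A)^{ - }$; from $t:(\neg A)^{+}$ infer $\neg\mathrm{E}^{+}(t):A^{\ominus}$; from $t:(\neg A)^{ - }$ infer $\neg\mathrm{E}^{ - }(t):A^{\oplus}$. (Quantifiers) if $\Gamma\vdash t:A^{\oplus}$, $\alpha\notin\mathrm{ftv}(\Gamma)$ then $\Gamma\vdash\Lambda^{+}\alpha.t:(\forall\alpha.A)^{+}$; if $\Gamma\vdash t:A^{\ominus}$, $\alpha\notin\mathrm{ftv}(\Gamma)$ then $\Gamma\vdash\Lambda^{ - }\alpha.t:(\exists\alpha.A)^{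 - }$; from $t:(\forall\alpha.B)^{+}$ infer $t[A]^{+}:B^{\oplus}[\alpha:=A]$; from $t:(\exists\alpha.B)^{ - }$ infer $t[A]^{ - }:B^{\ominus}[\alpha:=A]$; from $t:B^{\oplus}[\alpha:=A]$ infer $\langle A,t\rangle^{+}:(\exists\alpha.B)^{+}$; from $t:B^{\ominus}[\alpha:=A]$ infer $\langle A,t\rangle^{ - }:(\forall\alpha.B)^{ - }$; if $\Gamma\vdash t:(\exists\alpha.A)^{+}$, $\Gamma,x:A^{\oplus}\vdash s:P$, $\alpha\notin\mathrm{ftv}(\Gamma,P)$ then $\Gamma\vdash\mathrm{open}^{+}t\text{ as }(\alpha,x:A^{\oplus})\text{ in }s:P$; if $\Gamma\vdash t:(\forall\alpha.A)^{ - }$, $\Gamma,x:A^{\ominus}\vdash s:P$, $\alpha\notin\mathrm{ftv}(\Gamma,P)$ then $\Gamma\vdash\mathrm{open}^{ - }t\text{ as }(\alpha,x:A^{\ominus})\text{ in }s:P$. Intuitionistic terms: an occurrence of a subterm (or variable) in a term $t$ is useless if it lies inside the argument $s$ of some subterm of $t$ of the form $u\circ^{+}s$; otherwise it is useful. A term $t$ is intuitionistic iff (1) $t$ has no useful subterm of any of the forms $\mathrm{case}^{ - }\,r\,[x.s\mid y.u]$, $\mathrm{colam}^{ - }\,r\,[x,y.s]$, $\neg\mathrm{E}^{ - }(r)$, $\mathrm{open}^{ - }\,r\text{ as }(\alpha,x)\text{ in }s$; and (2) for every useful subterm of the form $\lambda^{+}_{\circ}(x:A^{\ominus}).r$, there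 is no useful occurrence of $x$ in $r$. $\Gamma\vdash_{\mathrm{PRJ}} t:P$ means $\Gamma\vdash t:P$ is derivable in $\lambda^{\mathrm{PRK}}$ and $t$ is intuitionistic. $\mathrm{NJ}$: formulas $A ::= \alpha\mid\bot\mid A\wedge A\mid A\vee A\mid A\to A\mid A\ltimes A\mid\neg A\mid\forall\alpha.A\mid\exists\alpha.A$ (second-order propositional quantification; pure types are formulas); sequents $\Gamma\vdash A$ with $\Gamma$ a finite list of formulas; rules: axiom $\Gamma,A\vdash A$; $\bot$-elimination; standard natural-deduction introduction/elimination rules for $\wedge,\vee,\to$; $\neg$-introduction ($\Gamma,A\vdash\bot$ gives $\Gamma\vdash\neg A$) and $\neg$-elimination ($\Gamma\vdash\neg A$, $\Gamma\vdash A$ give $\Gamma\vdash\bot$); $\ltimes$-introduction ($\Gamma\vdash\neg A$, $\Gamma\vdash B$ give $\Gamma\vdash A\ltimes B$) and $\ltimes$-elimination ($\Gamma\vdash A\ltimes B$ and $\Gamma,\neg A,B\vdash C$ give $\Gamma\vdash C$); $\forall$-introduction (from $\Gamma\vdash A$ with $\alpha\notin\mathrm{ftv}(\Gamma)$ infer $\Gamma\vdash\forall\alpha.A$), $\forall$-elimination (from $\Gamma\vdash\forall\alpha.B$ infer $\Gamma\vdash B[\alpha:=A]$ for any formula $A$), $\exists$-introduction (from $\Gamma\vdash B[\alpha:=A]$ infer $\Gamma\vdash\exists\alpha.B$), $\exists$-elimination (from $\Gamma\vdash\exists\alpha.A$ and $\Gamma,A\vdash B$ with $\alpha\notin\mathrm{ftv}(\Gamma,B)$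 infer $\Gamma\vdash B$). No excluded middle. -}

module Defs where

open import Data.Nat using (ℕ; zero; suc)
open import Data.Fin using (Fin; zero; suc)
open import Data.Bool using (Bool; true; false)
open import Data.List using (List; []; _∷_; map)
open import Data.List.Membership.Propositional using (_∈_)
open import Data.Product using (_×_; Σ)
open import Data.Unit using (⊤)
open import Data.Empty using (⊥)
open import Relation.Nullary using (¬_)
open import Relation.Binary.PropositionalEquality using (_≡_)

-- Second-order propositional formulas, scoped de Bruijn type variables.
-- `Fm b n` : formulas with at most n free type variables (Fin n);
-- the flag b says whether the constant ⊥ is allowed.

data Fm : Bool → ℕ → Set where
  tvar : ∀ {b n} → Fin n → Fm b n
  botₜ : ∀ {n} → Fm true n
  _∧ₜ_ _∨ₜ_ _⇒ₜ_ _⋉ₜ_ : ∀ {b n} → Fm b n → Fm b n → Fm b n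
  ¬ₜ_ : ∀ {b n} → Fm b n → Fm b n
  ∀ₜ ∃ₜ : ∀ {b n} → Fm b (suc n) → Fm b n

PureTy : ℕ → Set
PureTy = Fm false

Formula : ℕ → Set
Formula = Fm true

⌜_⌝ : ∀ {n} → PureTy n → Formula n
⌜ tvar i ⌝ = tvar i
⌜ A ∧ₜ B ⌝ = ⌜ A ⌝ ∧ₜ ⌜ B ⌝
⌜ A ∨ₜ B ⌝ = ⌜ A ⌝ ∨ₜ ⌜ B ⌝
⌜ A ⇒ₜ B ⌝ = ⌜ A ⌝ ⇒ₜ ⌜ B ⌝
⌜ A ⋉ₜ B ⌝ = ⌜ A ⌝ ⋉ₜ ⌜ B ⌝
⌜ ¬ₜ A ⌝ = ¬ₜ ⌜ A ⌝
⌜ ∀ₜ A ⌝ = ∀ₜ ⌜ A ⌝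
⌜ ∃ₜ A ⌝ = ∃ₜ ⌜ A ⌝

extR : ∀ {m n} → (Fin m → Fin n) → Fin (suc m) → Fin (suc n)
extR ρ zero = zero
extR ρ (suc i) = suc (ρ i)

ren : ∀ {b m n} → (Fin m → Fin n) → Fm b m → Fm b n
ren ρ (tvar i) = tvar (ρ i)
ren ρ botₜ = botₜ
ren ρ (A ∧ₜ B) = ren ρ A ∧ₜ ren ρ B
ren ρ (A ∨ₜ B) = ren ρ A ∨ₜ ren ρ B
ren ρ (A ⇒ₜ B) = ren ρ A ⇒ₜ ren ρ B
ren ρ (A ⋉ₜ B) = ren ρ A ⋉ₜ ren ρ B
ren ρ (¬ₜ A) = ¬ₜ ren ρ A
ren ρ (∀ₜ A) = ∀ₜ (ren (extR ρ) A)
ren ρ (∃ₜ A) = ∃ₜ (ren (extR ρ) A)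

wk : ∀ {b n} → Fm b n → Fm b (suc n)
wk = ren suc

extS : ∀ {b m n} → (Fin m → Fm b n) → Fin (suc m) → Fm b (suc n)
extS σ zero = tvar zero
extS σ (suc i) = wk (σ i)

sub : ∀ {b m n} → (Fin m → Fm b n) → Fm b m → Fm b n
sub σ (tvar i) = σ i
sub σ botₜ = botₜ
sub σ (A ∧ₜ B) = sub σ A ∧ₜ sub σ B
sub σ (A ∨ₜ B) = sub σ A ∨ₜ sub σ B
sub σ (A ⇒ₜ B) = sub σ A ⇒ₜ sub σ B
sub σ (A ⋉ₜ B) = sub σ A ⋉ₜ sub σ B
sub σ (¬ₜ A) = ¬ₜ sub σ A
sub σ (∀ₜ A) = ∀ₜ (sub (extS σ) A)
sub σ (∃ₜ A) = ∃ₜ (sub (extS σ) A)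

single : ∀ {b n} → Fm b n → Fin (suc n) → Fm b n
single A zero = A
single A (suc i) = tvar i

_[_] : ∀ {b n} → Fm b (suc n) → Fm b n → Fm b n
B [ A ] = sub (single A) B

-- Types of λPRK: a pure type with a mode at the root.

data MTy (n : ℕ) : Set where
  _⁺ _⁻ _⊕ _⊖ : PureTy n → MTy n

wkM : ∀ {n} → MTy n → MTy (suc n)
wkM (A ⁺) = wk A ⁺
wkM (A ⁻) = wk A ⁻
wkM (A ⊕) = wk A ⊕
wkM (A ⊖) = wk A ⊖

data Pol : Set where
  pos neg : Pol

data Idx : Set where
  ₁ ₂ : Idx

-- Term variables are de Bruijn indices (ℕ),
-- type variables are scoped de Bruijn (the index n of Tm n).
-- Binders:  lamw, lam, open bind one term variable in their body;
-- case binds one in each branch; colam binds x (index 1) and y (index 0);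
-- tlam and open bind one type variable.

data Tm : ℕ → Set where
  var    : ∀ {n} → ℕ → Tm n
  abs    : ∀ {n} → Tm n → Tm n → MTy n → Tm n
  lamw   : ∀ {n} → Pol → MTy n → Tm n → Tm n
  appw   : ∀ {n} → Pol → Tm n → Tm n → Tm n
  pair   : ∀ {n} → Pol → Tm n → Tm n → Tm n
  proj   : ∀ {n} → Pol → Idx → Tm n → Tm n
  inj    : ∀ {n} → Pol → Idx → Tm n → Tm n
  case   : ∀ {n} → Pol → Tm n → MTy n → Tm n → MTy n → Tm n → Tm n
  lam    : ∀ {n} → Pol → MTy n → Tm n → Tm n
  app    : ∀ {n} → Pol → Tm n → Tm n → Tm n
  copair : ∀ {n} → Pol → Tm n → Tm n → Tm n
  colam  : ∀ {n} → Pol → Tm n → MTy n → MTy n → Tm n → Tm n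
  negI   : ∀ {n} → Pol → Tm n → Tm n
  negE   : ∀ {n} → Pol → Tm n → Tm n
  tlam   : ∀ {n} → Pol → Tm (suc n) → Tm n
  tapp   : ∀ {n} → Pol → Tm n → PureTy n → Tm n
  pack   : ∀ {n} → Pol → PureTy n → Tm n → Tm n
  open'  : ∀ {n} → Pol → Tm n → MTy (suc n) → Tm (suc n) → Tm n

-- typing contexts: the most recently bound variable is at the head (index 0)
Ctx : ℕ → Set
Ctx n = List (MTy n)

data _∋_∶_ {n : ℕ} : Ctx n → ℕ → MTy n → Set where
  here  : ∀ {Γ P} → (P ∷ Γ) ∋ zero ∶ P
  there : ∀ {Γ P Q k} → Γ ∋ k ∶ P → (Q ∷ Γ) ∋ suc k ∶ P

-- "α ∉ ftv(Γ)" is expressed de Bruijn style: the premise lives in the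
-- extended type scope with Γ weakened.
wkCtx : ∀ {n} → Ctx n → Ctx (suc n)
wkCtx = map wkM

infix 4 _⊢_∶_
data _⊢_∶_ : ∀ {n} → Ctx n → Tm n → MTy n → Set where
  ax    : ∀ {n} {Γ : Ctx n} {k P} → Γ ∋ k ∶ P → Γ ⊢ var k ∶ P
  absR  : ∀ {n} {Γ : Ctx n} {A t s} (P : MTy n) →
          Γ ⊢ t ∶ A ⁺ → Γ ⊢ s ∶ A ⁻ → Γ ⊢ abs t s P ∶ P
  lamw⁺ : ∀ {n} {Γ : Ctx n} {A t} → ((A ⊖) ∷ Γ) ⊢ t ∶ A ⁺ → Γ ⊢ lamw pos (A ⊖) t ∶ A ⊕
  lamw⁻ : ∀ {n} {Γ : Ctx n} {A t} → ((A ⊕) ∷ Γ) ⊢ t ∶ A ⁻ → Γ ⊢ lamw neg (A ⊕) t ∶ A ⊖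
  appw⁺ : ∀ {n} {Γ : Ctx n} {A t s} → Γ ⊢ t ∶ A ⊕ → Γ ⊢ s ∶ A ⊖ → Γ ⊢ appw pos t s ∶ A ⁺
  appw⁻ : ∀ {n} {Γ : Ctx n} {A t s} → Γ ⊢ t ∶ A ⊖ → Γ ⊢ s ∶ A ⊕ → Γ ⊢ appw neg t s ∶ A ⁻
  pair⁺ : ∀ {n} {Γ : Ctx n} {A B t s} → Γ ⊢ t ∶ A ⊕ → Γ ⊢ s ∶ B ⊕ → Γ ⊢ pair pos t s ∶ (A ∧ₜ B) ⁺
  pair⁻ : ∀ {n} {Γ : Ctx n} {A B t s} → Γ ⊢ t ∶ A ⊖ → Γ ⊢ s ∶ B ⊖ → Γ ⊢ pair neg t s ∶ (A ∨ₜ B) ⁻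
  proj⁺₁ : ∀ {n} {Γ : Ctx n} {A B t} → Γ ⊢ t ∶ (A ∧ₜ B) ⁺ → Γ ⊢ proj pos ₁ t ∶ A ⊕
  proj⁺₂ : ∀ {n} {Γ : Ctx n} {A B t} → Γ ⊢ t ∶ (A ∧ₜ B) ⁺ → Γ ⊢ proj pos ₂ t ∶ B ⊕
  proj⁻₁ : ∀ {n} {Γ : Ctx n} {A B t} → Γ ⊢ t ∶ (A ∨ₜ B) ⁻ → Γ ⊢ proj neg ₁ t ∶ A ⊖
  proj⁻₂ : ∀ {n} {Γ : Ctx n} {A B t} → Γ ⊢ t ∶ (A ∨ₜ B) ⁻ → Γ ⊢ proj neg ₂ t ∶ B ⊖
  inj⁺₁ : ∀ {n} {Γ : Ctx n} {A B t} → Γ ⊢ t ∶ A ⊕ → Γ ⊢ inj pos ₁ t ∶ (A ∨ₜ B) ⁺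
  inj⁺₂ : ∀ {n} {Γ : Ctx n} {A B t} → Γ ⊢ t ∶ B ⊕ → Γ ⊢ inj pos ₂ t ∶ (A ∨ₜ B) ⁺
  inj⁻₁ : ∀ {n} {Γ : Ctx n} {A B t} → Γ ⊢ t ∶ A ⊖ → Γ ⊢ inj neg ₁ t ∶ (A ∧ₜ B) ⁻
  inj⁻₂ : ∀ {n} {Γ : Ctx n} {A B t} → Γ ⊢ t ∶ B ⊖ → Γ ⊢ inj neg ₂ t ∶ (A ∧ₜ B) ⁻
  case⁺ : ∀ {n} {Γ : Ctx n} {A B P t s u} → Γ ⊢ t ∶ (A ∨ₜ B) ⁺ →
          ((A ⊕) ∷ Γ) ⊢ s ∶ P → ((B ⊕) ∷ Γ) ⊢ u ∶ P →
          Γ ⊢ case pos t (A ⊕) s (B ⊕) u ∶ P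
  case⁻ : ∀ {n} {Γ : Ctx n} {A B P t s u} → Γ ⊢ t ∶ (A ∧ₜ B) ⁻ →
          ((A ⊖) ∷ Γ) ⊢ s ∶ P → ((B ⊖) ∷ Γ) ⊢ u ∶ P →
          Γ ⊢ case neg t (A ⊖) s (B ⊖) u ∶ P
  lam⁺ : ∀ {n} {Γ : Ctx n} {A B t} → ((A ⊕) ∷ Γ) ⊢ t ∶ B ⊕ → Γ ⊢ lam pos (A ⊕) t ∶ (A ⇒ₜ B) ⁺
  lam⁻ : ∀ {n} {Γ : Ctx n} {A B t} → ((A ⊖) ∷ Γ) ⊢ t ∶ B ⊖ → Γ ⊢ lam neg (A ⊖) t ∶ (A ⋉ₜ B) ⁻
  app⁺ : ∀ {n} {Γ : Ctx n} {A B t s} → Γ ⊢ t ∶ (A ⇒ₜ B) ⁺ → Γ ⊢ s ∶ A ⊕ → Γ ⊢ app pos t s ∶ B ⊕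
  app⁻ : ∀ {n} {Γ : Ctx n} {A B t s} → Γ ⊢ t ∶ (A ⋉ₜ B) ⁻ → Γ ⊢ s ∶ A ⊖ → Γ ⊢ app neg t s ∶ B ⊖
  copair⁺ : ∀ {n} {Γ : Ctx n} {A B t s} → Γ ⊢ t ∶ A ⊖ → Γ ⊢ s ∶ B ⊕ → Γ ⊢ copair pos t s ∶ (A ⋉ₜ B) ⁺
  copair⁻ : ∀ {n} {Γ : Ctx n} {A B t s} → Γ ⊢ t ∶ A ⊕ → Γ ⊢ s ∶ B ⊖ → Γ ⊢ copair neg t s ∶ (A ⇒ₜ B) ⁻
  colam⁺ : ∀ {n} {Γ : Ctx n} {A B P t s} → Γ ⊢ t ∶ (A ⋉ₜ B) ⁺ →
           ((B ⊕) ∷ (A ⊖) ∷ Γ) ⊢ s ∶ P → Γ ⊢ colam pos t (A ⊖) (B ⊕) s ∶ P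
  colam⁻ : ∀ {n} {Γ : Ctx n} {A B P t s} → Γ ⊢ t ∶ (A ⇒ₜ B) ⁻ →
           ((B ⊖) ∷ (A ⊕) ∷ Γ) ⊢ s ∶ P → Γ ⊢ colam neg t (A ⊕) (B ⊖) s ∶ P
  negI⁺ : ∀ {n} {Γ : Ctx n} {A t} → Γ ⊢ t ∶ A ⊖ → Γ ⊢ negI pos t ∶ (¬ₜ A) ⁺
  negI⁻ : ∀ {n} {Γ : Ctx n} {A t} → Γ ⊢ t ∶ A ⊕ → Γ ⊢ negI neg t ∶ (¬ₜ A) ⁻
  negE⁺ : ∀ {n} {Γ : Ctx n} {A t} → Γ ⊢ t ∶ (¬ₜ A) ⁺ → Γ ⊢ negE pos t ∶ A ⊖
  negE⁻ : ∀ {n} {Γ : Ctx n} {A t} → Γ ⊢ t ∶ (¬ₜ A) ⁻ → Γ ⊢ negE neg t ∶ A ⊕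
  tlam⁺ : ∀ {n} {Γ : Ctx n} {A t} → wkCtx Γ ⊢ t ∶ A ⊕ → Γ ⊢ tlam pos t ∶ (∀ₜ A) ⁺
  tlam⁻ : ∀ {n} {Γ : Ctx n} {A t} → wkCtx Γ ⊢ t ∶ A ⊖ → Γ ⊢ tlam neg t ∶ (∃ₜ A) ⁻
  tapp⁺ : ∀ {n} {Γ : Ctx n} {B t} (A : PureTy n) → Γ ⊢ t ∶ (∀ₜ B) ⁺ → Γ ⊢ tapp pos t A ∶ (B [ A ]) ⊕
  tapp⁻ : ∀ {n} {Γ : Ctx n} {B t} (A : PureTy n) → Γ ⊢ t ∶ (∃ₜ B) ⁻ → Γ ⊢ tapp neg t A ∶ (B [ A ]) ⊖
  pack⁺ : ∀ {n} {Γ : Ctx n} {B t} (A : PureTy n) → Γ ⊢ t ∶ (B [ A ]) ⊕ → Γ ⊢ pack pos A t ∶ (∃ₜ B) ⁺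
  pack⁻ : ∀ {n} {Γ : Ctx n} {B t} (A : PureTy n) → Γ ⊢ t ∶ (B [ A ]) ⊖ → Γ ⊢ pack neg A t ∶ (∀ₜ B) ⁻
  open⁺ : ∀ {n} {Γ : Ctx n} {A P t s} → Γ ⊢ t ∶ (∃ₜ A) ⁺ →
          ((A ⊕) ∷ wkCtx Γ) ⊢ s ∶ wkM P → Γ ⊢ open' pos t (A ⊕) s ∶ P
  open⁻ : ∀ {n} {Γ : Ctx n} {A P t s} → Γ ⊢ t ∶ (∀ₜ A) ⁻ →
          ((A ⊖) ∷ wkCtx Γ) ⊢ s ∶ wkM P → Γ ⊢ open' neg t (A ⊖) s ∶ P

-- An occurrence is useless iff it lies inside the argument s of some
-- subterm u ∘⁺ s; so "useful" positions are exactly those reached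
-- without entering the right argument of appw pos.

NoUsefulOcc : ∀ {n} → ℕ → Tm n → Set
NoUsefulOcc x (var y) = ¬ (x ≡ y)
NoUsefulOcc x (abs t s P) = NoUsefulOcc x t × NoUsefulOcc x s
NoUsefulOcc x (lamw ε P t) = NoUsefulOcc (suc x) t
NoUsefulOcc x (appw pos t s) = NoUsefulOcc x t
NoUsefulOcc x (appw neg t s) = NoUsefulOcc x t × NoUsefulOcc x s
NoUsefulOcc x (pair ε t s) = NoUsefulOcc x t × NoUsefulOcc x s
NoUsefulOcc x (proj ε i t) = NoUsefulOcc x t
NoUsefulOcc x (inj ε i t) = NoUsefulOcc x t
NoUsefulOcc x (case ε t P s Q u) =
  NoUsefulOcc x t × NoUsefulOcc (suc x) s × NoUsefulOcc (suc x) u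
NoUsefulOcc x (lam ε P t) = NoUsefulOcc (suc x) t
NoUsefulOcc x (app ε t s) = NoUsefulOcc x t × NoUsefulOcc x s
NoUsefulOcc x (copair ε t s) = NoUsefulOcc x t × NoUsefulOcc x s
NoUsefulOcc x (colam ε t P Q s) = NoUsefulOcc x t × NoUsefulOcc (suc (suc x)) s
NoUsefulOcc x (negI ε t) = NoUsefulOcc x t
NoUsefulOcc x (negE ε t) = NoUsefulOcc x t
NoUsefulOcc x (tlam ε t) = NoUsefulOcc x t
NoUsefulOcc x (tapp ε t A) = NoUsefulOcc x t
NoUsefulOcc x (pack ε A t) = NoUsefulOcc x t
NoUsefulOcc x (open' ε t P s) = NoUsefulOcc x t × NoUsefulOcc (suc x) s

-- Intuitionistic t : (1) no useful case⁻, colam⁻, ¬E⁻, open⁻; and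
-- (2) every useful λ⁺_∘(x). r has no useful occurrence of x in r.
Intuitionistic : ∀ {n} → Tm n → Set
Intuitionistic (var y) = ⊤
Intuitionistic (abs t s P) = Intuitionistic t × Intuitionistic s
Intuitionistic (lamw pos P t) = Intuitionistic t × NoUsefulOcc zero t
Intuitionistic (lamw neg P t) = Intuitionistic t
Intuitionistic (appw pos t s) = Intuitionistic t
Intuitionistic (appw neg t s) = Intuitionistic t × Intuitionistic s
Intuitionistic (pair ε t s) = Intuitionistic t × Intuitionistic s
Intuitionistic (proj ε i t) = Intuitionistic t
Intuitionistic (inj ε i t) = Intuitionistic t
Intuitionistic (case pos t P s Q u) = Intuitionistic t × Intuitionistic s × Intuitionistic u
Intuitionistic (case neg t P s Q u) = ⊥
Intuitionistic (lam ε P t) = Intuitionistic t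
Intuitionistic (app ε t s) = Intuitionistic t × Intuitionistic s
Intuitionistic (copair ε t s) = Intuitionistic t × Intuitionistic s
Intuitionistic (colam pos t P Q s) = Intuitionistic t × Intuitionistic s
Intuitionistic (colam neg t P Q s) = ⊥
Intuitionistic (negI ε t) = Intuitionistic t
Intuitionistic (negE pos t) = Intuitionistic t
Intuitionistic (negE neg t) = ⊥
Intuitionistic (tlam ε t) = Intuitionistic t
Intuitionistic (tapp ε t A) = Intuitionistic t
Intuitionistic (pack ε A t) = Intuitionistic t
Intuitionistic (open' pos t P s) = Intuitionistic t × Intuitionistic s
Intuitionistic (open' neg t P s) = ⊥

infix 4 _⊢PRJ_∶_
_⊢PRJ_∶_ : ∀ {n} → Ctx n → Tm n → MTy n → Set
Γ ⊢PRJ t ∶ P = (Γ ⊢ t ∶ P) × Intuitionistic t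

FCtx : ℕ → Set
FCtx n = List (Formula n)

infix 4 _⊢NJ_
data _⊢NJ_ : ∀ {n} → FCtx n → Formula n → Set where
  axNJ  : ∀ {n} {Γ : FCtx n} {A} → A ∈ Γ → Γ ⊢NJ A
  ⊥E    : ∀ {n} {Γ : FCtx n} {C} → Γ ⊢NJ botₜ → Γ ⊢NJ C
  ∧I    : ∀ {n} {Γ : FCtx n} {A B} → Γ ⊢NJ A → Γ ⊢NJ B → Γ ⊢NJ A ∧ₜ B
  ∧E₁   : ∀ {n} {Γ : FCtx n} {A B} → Γ ⊢NJ A ∧ₜ B → Γ ⊢NJ A
  ∧E₂   : ∀ {n} {Γ : FCtx n} {A B} → Γ ⊢NJ A ∧ₜ B → Γ ⊢NJ B
  ∨I₁   : ∀ {n} {Γ : FCtx n} {A B} → Γ ⊢NJ A → Γ ⊢NJ A ∨ₜ B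
  ∨I₂   : ∀ {n} {Γ : FCtx n} {A B} → Γ ⊢NJ B → Γ ⊢NJ A ∨ₜ B
  ∨E    : ∀ {n} {Γ : FCtx n} {A B C} → Γ ⊢NJ A ∨ₜ B →
          (A ∷ Γ) ⊢NJ C → (B ∷ Γ) ⊢NJ C → Γ ⊢NJ C
  ⇒I    : ∀ {n} {Γ : FCtx n} {A B} → (A ∷ Γ) ⊢NJ B → Γ ⊢NJ A ⇒ₜ B
  ⇒E    : ∀ {n} {Γ : FCtx n} {A B} → Γ ⊢NJ A ⇒ₜ B → Γ ⊢NJ A → Γ ⊢NJ B
  ¬I    : ∀ {n} {Γ : FCtx n} {A} → (A ∷ Γ) ⊢NJ botₜ → Γ ⊢NJ ¬ₜ A
  ¬E    : ∀ {n} {Γ : FCtx n} {A} → Γ ⊢NJ ¬ₜ A → Γ ⊢NJ A → Γ ⊢NJ botₜ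
  ⋉I    : ∀ {n} {Γ : FCtx n} {A B} → Γ ⊢NJ ¬ₜ A → Γ ⊢NJ B → Γ ⊢NJ A ⋉ₜ B
  ⋉E    : ∀ {n} {Γ : FCtx n} {A B C} → Γ ⊢NJ A ⋉ₜ B →
          (B ∷ (¬ₜ A) ∷ Γ) ⊢NJ C → Γ ⊢NJ C
  ∀I    : ∀ {n} {Γ : FCtx n} {A} → map wk Γ ⊢NJ A → Γ ⊢NJ ∀ₜ A
  ∀E    : ∀ {n} {Γ : FCtx n} {B} (A : Formula n) → Γ ⊢NJ ∀ₜ B → Γ ⊢NJ B [ A ]
  ∃I    : ∀ {n} {Γ : FCtx n} {B} (A : Formula n) → Γ ⊢NJ B [ A ] → Γ ⊢NJ ∃ₜ B
  ∃E    : ∀ {n} {Γ : FCtx n} {A B} → Γ ⊢NJ ∃ₜ A →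
          (A ∷ map wk Γ) ⊢NJ wk B → Γ ⊢NJ B

-- Soundness: read A⁺ and A⊕ as A, and A⁻ and A⊖ as ¬A. Every typing rule then becomes
-- a derivable rule of NJ, except the four negative eliminations excluded from intuitionistic
-- terms, which are the classical ones. The argument s of t ∘⁺ s is dropped, since A⊕ and A⁺
-- are read alike; the variable of a useful λ⁺∘ occurs only in such dropped positions, so it
-- can be read as the provable formula ⊥ ⇒ ⊥ instead of its refutation ¬A.
--
-- Completeness: read formulas back, with ⊥ as ∀α.α, and realise each rule of NJ by a term
-- of weak type A⊕. An elimination needs its premiss A⊕ in strong form A⁺, at the cost of an
-- argument of type A⊖. That argument sits in a useless position, so it may use classical
-- reasoning and the continuation k of an enclosing λ⁺∘(k : C⊖), which refutes the goal.

module Submission where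

open import Defs
open import Data.Nat using (ℕ; zero; suc)
open import Data.Fin using (Fin; zero; suc; toℕ)
open import Data.List using (List; []; _∷_; map)
open import Data.Bool using (Bool; true; false; T; if_then_else_)
open import Data.Product using (Σ; _×_; _,_; -,_; proj₁; proj₂)
open import Data.Unit using (tt)
open import Data.Empty using (⊥-elim)
open import Data.List.Membership.Propositional using (_∈_)
open import Data.List.Membership.Propositional.Properties using (∈-map⁻)
open import Data.List.Relation.Unary.Any using (here; there; index)
open import Data.List.Relation.Binary.Subset.Propositional using (_⊆_)
import Data.List.Relation.Binary.Subset.Propositional.Properties as ⊆
open import Function using (_∘_; id; const)
open import Relation.Binary.PropositionalEquality
  using (_≡_; refl; sym; trans; cong; cong₂; subst; subst₂; _≗_)
open import Function.Bundles using (_⇔_; mk⇔)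

private variable
  m n : ℕ
  Γ Γ′ : FCtx n
  φ ψ χ : Formula n
  A B C : PureTy n
  F : List Bool
  a : Tm n
  Δ Δ′ : Ctx n
  P : MTy n
  t s u : Tm n
  X : List Bool
  b : Bool
  k : ℕ

⌜⌝-ren : (ρ : Fin m → Fin n) (A : PureTy m) → ⌜ ren ρ A ⌝ ≡ ren ρ ⌜ A ⌝
⌜⌝-ren ρ (tvar i) = refl
⌜⌝-ren ρ (A ∧ₜ B) = cong₂ _∧ₜ_ (⌜⌝-ren ρ A) (⌜⌝-ren ρ B)
⌜⌝-ren ρ (A ∨ₜ B) = cong₂ _∨ₜ_ (⌜⌝-ren ρ A) (⌜⌝-ren ρ B)
⌜⌝-ren ρ (A ⇒ₜ B) = cong₂ _⇒ₜ_ (⌜⌝-ren ρ A) (⌜⌝-ren ρ B)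
⌜⌝-ren ρ (A ⋉ₜ B) = cong₂ _⋉ₜ_ (⌜⌝-ren ρ A) (⌜⌝-ren ρ B)
⌜⌝-ren ρ (¬ₜ A) = cong ¬ₜ_ (⌜⌝-ren ρ A)
⌜⌝-ren ρ (∀ₜ A) = cong ∀ₜ (⌜⌝-ren (extR ρ) A)
⌜⌝-ren ρ (∃ₜ A) = cong ∃ₜ (⌜⌝-ren (extR ρ) A)

⌜⌝-extS : {σ : Fin m → PureTy n} {σ′ : Fin m → Formula n} →
          ⌜_⌝ ∘ σ ≗ σ′ → ⌜_⌝ ∘ extS σ ≗ extS σ′
⌜⌝-extS eq zero = refl
⌜⌝-extS {σ = σ} eq (suc i) = trans (⌜⌝-ren suc (σ i)) (cong wk (eq i))

⌜⌝-sub : {σ : Fin m → PureTy n} {σ′ : Fin m → Formula n} →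
         ⌜_⌝ ∘ σ ≗ σ′ → (A : PureTy m) → ⌜ sub σ A ⌝ ≡ sub σ′ ⌜ A ⌝
⌜⌝-sub eq (tvar i) = eq i
⌜⌝-sub eq (A ∧ₜ B) = cong₂ _∧ₜ_ (⌜⌝-sub eq A) (⌜⌝-sub eq B)
⌜⌝-sub eq (A ∨ₜ B) = cong₂ _∨ₜ_ (⌜⌝-sub eq A) (⌜⌝-sub eq B)
⌜⌝-sub eq (A ⇒ₜ B) = cong₂ _⇒ₜ_ (⌜⌝-sub eq A) (⌜⌝-sub eq B)
⌜⌝-sub eq (A ⋉ₜ B) = cong₂ _⋉ₜ_ (⌜⌝-sub eq A) (⌜⌝-sub eq B)
⌜⌝-sub eq (¬ₜ A) = cong ¬ₜ_ (⌜⌝-sub eq A)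
⌜⌝-sub eq (∀ₜ A) = cong ∀ₜ (⌜⌝-sub (⌜⌝-extS eq) A)
⌜⌝-sub eq (∃ₜ A) = cong ∃ₜ (⌜⌝-sub (⌜⌝-extS eq) A)

⌜⌝-single : (A : PureTy n) → ⌜_⌝ ∘ single A ≗ single ⌜ A ⌝
⌜⌝-single A zero = refl
⌜⌝-single A (suc i) = refl

⌜⌝-[] : (B : PureTy (suc n)) (A : PureTy n) → ⌜ B [ A ] ⌝ ≡ ⌜ B ⌝ [ ⌜ A ⌝ ]
⌜⌝-[] B A = ⌜⌝-sub (⌜⌝-single A) B

⊥ₚ : PureTy n
⊥ₚ = ∀ₜ (tvar zero)

⌞_⌟ : Formula n → PureTy n
⌞ tvar i ⌟ = tvar i
⌞ botₜ ⌟ = ⊥ₚ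
⌞ φ ∧ₜ ψ ⌟ = ⌞ φ ⌟ ∧ₜ ⌞ ψ ⌟
⌞ φ ∨ₜ ψ ⌟ = ⌞ φ ⌟ ∨ₜ ⌞ ψ ⌟
⌞ φ ⇒ₜ ψ ⌟ = ⌞ φ ⌟ ⇒ₜ ⌞ ψ ⌟
⌞ φ ⋉ₜ ψ ⌟ = ⌞ φ ⌟ ⋉ₜ ⌞ ψ ⌟
⌞ ¬ₜ φ ⌟ = ¬ₜ ⌞ φ ⌟
⌞ ∀ₜ φ ⌟ = ∀ₜ ⌞ φ ⌟
⌞ ∃ₜ φ ⌟ = ∃ₜ ⌞ φ ⌟

⌞⌟-ren : (ρ : Fin m → Fin n) (φ : Formula m) → ⌞ ren ρ φ ⌟ ≡ ren ρ ⌞ φ ⌟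
⌞⌟-ren ρ (tvar i) = refl
⌞⌟-ren ρ botₜ = refl
⌞⌟-ren ρ (φ ∧ₜ ψ) = cong₂ _∧ₜ_ (⌞⌟-ren ρ φ) (⌞⌟-ren ρ ψ)
⌞⌟-ren ρ (φ ∨ₜ ψ) = cong₂ _∨ₜ_ (⌞⌟-ren ρ φ) (⌞⌟-ren ρ ψ)
⌞⌟-ren ρ (φ ⇒ₜ ψ) = cong₂ _⇒ₜ_ (⌞⌟-ren ρ φ) (⌞⌟-ren ρ ψ)
⌞⌟-ren ρ (φ ⋉ₜ ψ) = cong₂ _⋉ₜ_ (⌞⌟-ren ρ φ) (⌞⌟-ren ρ ψ)
⌞⌟-ren ρ (¬ₜ φ) = cong ¬ₜ_ (⌞⌟-ren ρ φ)
⌞⌟-ren ρ (∀ₜ φ) = cong ∀ₜ (⌞⌟-ren (extR ρ) φ)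
⌞⌟-ren ρ (∃ₜ φ) = cong ∃ₜ (⌞⌟-ren (extR ρ) φ)

⌞⌟-extS : {σ : Fin m → Formula n} {σ′ : Fin m → PureTy n} →
          ⌞_⌟ ∘ σ ≗ σ′ → ⌞_⌟ ∘ extS σ ≗ extS σ′
⌞⌟-extS eq zero = refl
⌞⌟-extS {σ = σ} eq (suc i) = trans (⌞⌟-ren suc (σ i)) (cong wk (eq i))

⌞⌟-sub : {σ : Fin m → Formula n} {σ′ : Fin m → PureTy n} →
         ⌞_⌟ ∘ σ ≗ σ′ → (φ : Formula m) → ⌞ sub σ φ ⌟ ≡ sub σ′ ⌞ φ ⌟
⌞⌟-sub eq (tvar i) = eq i
⌞⌟-sub eq botₜ = refl
⌞⌟-sub eq (φ ∧ₜ ψ) = cong₂ _∧ₜ_ (⌞⌟-sub eq φ) (⌞⌟-sub eq ψ)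
⌞⌟-sub eq (φ ∨ₜ ψ) = cong₂ _∨ₜ_ (⌞⌟-sub eq φ) (⌞⌟-sub eq ψ)
⌞⌟-sub eq (φ ⇒ₜ ψ) = cong₂ _⇒ₜ_ (⌞⌟-sub eq φ) (⌞⌟-sub eq ψ)
⌞⌟-sub eq (φ ⋉ₜ ψ) = cong₂ _⋉ₜ_ (⌞⌟-sub eq φ) (⌞⌟-sub eq ψ)
⌞⌟-sub eq (¬ₜ φ) = cong ¬ₜ_ (⌞⌟-sub eq φ)
⌞⌟-sub eq (∀ₜ φ) = cong ∀ₜ (⌞⌟-sub (⌞⌟-extS eq) φ)
⌞⌟-sub eq (∃ₜ φ) = cong ∃ₜ (⌞⌟-sub (⌞⌟-extS eq) φ)

⌞⌟-single : (φ : Formula n) → ⌞_⌟ ∘ single φ ≗ single ⌞ φ ⌟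
⌞⌟-single φ zero = refl
⌞⌟-single φ (suc i) = refl

⌞⌟-[] : (ψ : Formula (suc n)) (φ : Formula n) → ⌞ ψ [ φ ] ⌟ ≡ ⌞ ψ ⌟ [ ⌞ φ ⌟ ]
⌞⌟-[] ψ φ = ⌞⌟-sub (⌞⌟-single φ) ψ

⌞⌜⌝⌟ : (A : PureTy n) → ⌞ ⌜ A ⌝ ⌟ ≡ A
⌞⌜⌝⌟ (tvar i) = refl
⌞⌜⌝⌟ (A ∧ₜ B) = cong₂ _∧ₜ_ (⌞⌜⌝⌟ A) (⌞⌜⌝⌟ B)
⌞⌜⌝⌟ (A ∨ₜ B) = cong₂ _∨ₜ_ (⌞⌜⌝⌟ A) (⌞⌜⌝⌟ B)
⌞⌜⌝⌟ (A ⇒ₜ B) = cong₂ _⇒ₜ_ (⌞⌜⌝⌟ A) (⌞⌜⌝⌟ B)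
⌞⌜⌝⌟ (A ⋉ₜ B) = cong₂ _⋉ₜ_ (⌞⌜⌝⌟ A) (⌞⌜⌝⌟ B)
⌞⌜⌝⌟ (¬ₜ A) = cong ¬ₜ_ (⌞⌜⌝⌟ A)
⌞⌜⌝⌟ (∀ₜ A) = cong ∀ₜ (⌞⌜⌝⌟ A)
⌞⌜⌝⌟ (∃ₜ A) = cong ∃ₜ (⌞⌜⌝⌟ A)

⊢NJ-weaken : Γ ⊆ Γ′ → Γ ⊢NJ φ → Γ′ ⊢NJ φ
⊢NJ-weaken s (axNJ p) = axNJ (s p)
⊢NJ-weaken s (⊥E d) = ⊥E (⊢NJ-weaken s d)
⊢NJ-weaken s (∧I d e) = ∧I (⊢NJ-weaken s d) (⊢NJ-weaken s e)
⊢NJ-weaken s (∧E₁ d) = ∧E₁ (⊢NJ-weaken s d)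
⊢NJ-weaken s (∧E₂ d) = ∧E₂ (⊢NJ-weaken s d)
⊢NJ-weaken s (∨I₁ d) = ∨I₁ (⊢NJ-weaken s d)
⊢NJ-weaken s (∨I₂ d) = ∨I₂ (⊢NJ-weaken s d)
⊢NJ-weaken s (∨E d e f) = ∨E (⊢NJ-weaken s d) (⊢NJ-weaken (⊆.∷⁺ʳ _ s) e) (⊢NJ-weaken (⊆.∷⁺ʳ _ s) f)
⊢NJ-weaken s (⇒I d) = ⇒I (⊢NJ-weaken (⊆.∷⁺ʳ _ s) d)
⊢NJ-weaken s (⇒E d e) = ⇒E (⊢NJ-weaken s d) (⊢NJ-weaken s e)
⊢NJ-weaken s (¬I d) = ¬I (⊢NJ-weaken (⊆.∷⁺ʳ _ s) d)
⊢NJ-weaken s (¬E d e) = ¬E (⊢NJ-weaken s d) (⊢NJ-weaken s e)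
⊢NJ-weaken s (⋉I d e) = ⋉I (⊢NJ-weaken s d) (⊢NJ-weaken s e)
⊢NJ-weaken s (⋉E d e) = ⋉E (⊢NJ-weaken s d) (⊢NJ-weaken (⊆.∷⁺ʳ _ (⊆.∷⁺ʳ _ s)) e)
⊢NJ-weaken s (∀I d) = ∀I (⊢NJ-weaken (⊆.map⁺ wk s) d)
⊢NJ-weaken s (∀E φ d) = ∀E φ (⊢NJ-weaken s d)
⊢NJ-weaken s (∃I φ d) = ∃I φ (⊢NJ-weaken s d)
⊢NJ-weaken s (∃E d e) = ∃E (⊢NJ-weaken s d) (⊢NJ-weaken (⊆.∷⁺ʳ _ (⊆.map⁺ wk s)) e)

⊢NJ-weaken₁ : Γ ⊢NJ φ → (ψ ∷ Γ) ⊢NJ φ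
⊢NJ-weaken₁ = ⊢NJ-weaken there

⊢NJ-weaken₂ : Γ ⊢NJ φ → (ψ ∷ χ ∷ Γ) ⊢NJ φ
⊢NJ-weaken₂ = ⊢NJ-weaken (λ p → there (there p))

assume : (φ ∷ Γ) ⊢NJ φ
assume = axNJ (here refl)

⊤ₜ : Formula n
⊤ₜ = botₜ ⇒ₜ botₜ

discharge-⊤ₜ : (⊤ₜ ∷ Γ) ⊢NJ φ → Γ ⊢NJ φ
discharge-⊤ₜ d = ⇒E (⇒I d) (⇒I assume)

contradictionNJ : Γ ⊢NJ ¬ₜ φ → Γ ⊢NJ φ → Γ ⊢NJ χ
contradictionNJ d e = ⊥E (¬E d e)

¬I-contract : (φ ∷ Γ) ⊢NJ ¬ₜ φ → Γ ⊢NJ ¬ₜ φ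
¬I-contract d = ¬I (¬E d assume)

¬¬I : Γ ⊢NJ φ → Γ ⊢NJ ¬ₜ ¬ₜ φ
¬¬I d = ¬I (¬E assume (⊢NJ-weaken₁ d))

¬∨I : Γ ⊢NJ ¬ₜ φ → Γ ⊢NJ ¬ₜ ψ → Γ ⊢NJ ¬ₜ (φ ∨ₜ ψ)
¬∨I d e = ¬I (∨E assume (¬E (⊢NJ-weaken₂ d) assume) (¬E (⊢NJ-weaken₂ e) assume))

¬∨E₁ : Γ ⊢NJ ¬ₜ (φ ∨ₜ ψ) → Γ ⊢NJ ¬ₜ φ
¬∨E₁ d = ¬I (¬E (⊢NJ-weaken₁ d) (∨I₁ assume))

¬∨E₂ : Γ ⊢NJ ¬ₜ (φ ∨ₜ ψ) → Γ ⊢NJ ¬ₜ ψ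
¬∨E₂ d = ¬I (¬E (⊢NJ-weaken₁ d) (∨I₂ assume))

¬∧I₁ : Γ ⊢NJ ¬ₜ φ → Γ ⊢NJ ¬ₜ (φ ∧ₜ ψ)
¬∧I₁ d = ¬I (¬E (⊢NJ-weaken₁ d) (∧E₁ assume))

¬∧I₂ : Γ ⊢NJ ¬ₜ ψ → Γ ⊢NJ ¬ₜ (φ ∧ₜ ψ)
¬∧I₂ d = ¬I (¬E (⊢NJ-weaken₁ d) (∧E₂ assume))

¬⇒I : Γ ⊢NJ φ → Γ ⊢NJ ¬ₜ ψ → Γ ⊢NJ ¬ₜ (φ ⇒ₜ ψ)
¬⇒I d e = ¬I (¬E (⊢NJ-weaken₁ e) (⇒E assume (⊢NJ-weaken₁ d)))

¬⋉I : (¬ₜ φ ∷ Γ) ⊢NJ ¬ₜ ψ → Γ ⊢NJ ¬ₜ (φ ⋉ₜ ψ)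
¬⋉I d = ¬I (⋉E assume (¬E (⊢NJ-weaken (λ p → there (⊆.∷⁺ʳ _ there p)) d) assume))

¬⋉E : Γ ⊢NJ ¬ₜ (φ ⋉ₜ ψ) → Γ ⊢NJ ¬ₜ φ → Γ ⊢NJ ¬ₜ ψ
¬⋉E d e = ¬I (¬E (⊢NJ-weaken₁ d) (⋉I (⊢NJ-weaken₁ e) assume))

¬∃I : map wk Γ ⊢NJ ¬ₜ φ → Γ ⊢NJ ¬ₜ ∃ₜ φ
¬∃I d = ¬I (∃E assume (¬E (⊢NJ-weaken₂ d) assume))

¬∃E : (φ : Formula n) → Γ ⊢NJ ¬ₜ ∃ₜ ψ → Γ ⊢NJ ¬ₜ (ψ [ φ ])
¬∃E φ d = ¬I (¬E (⊢NJ-weaken₁ d) (∃I φ assume))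

¬∀I : (φ : Formula n) → Γ ⊢NJ ¬ₜ (ψ [ φ ]) → Γ ⊢NJ ¬ₜ ∀ₜ ψ
¬∀I φ d = ¬I (¬E (⊢NJ-weaken₁ d) (∀E φ assume))

-- Soundness

-- Variables beyond the end of a marking are unmarked.
marked : List Bool → ℕ → Bool
marked [] k = false
marked (b ∷ X) zero = b
marked (b ∷ X) (suc k) = marked X k

record Avoids (X : List Bool) (t : Tm n) : Set where
  constructor avoiding
  field avoids : ∀ x → T (marked X x) → NoUsefulOcc x t
open Avoids

avoids-map : (∀ {x} → NoUsefulOcc x u → NoUsefulOcc x t) → Avoids X u → Avoids X t
avoids-map f h = avoiding λ x → f {x} ∘ avoids h x

avoids-under : (T b → NoUsefulOcc zero t) → (∀ {x} → NoUsefulOcc x u → NoUsefulOcc (suc x) t) →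
               Avoids X u → Avoids (b ∷ X) t
avoids-under z f h = avoiding λ where
  zero → z
  (suc x) → f {x} ∘ avoids h x

avoids-bound : (∀ {x} → NoUsefulOcc x u → NoUsefulOcc (suc x) t) → Avoids X u → Avoids (false ∷ X) t
avoids-bound = avoids-under (λ ())

avoids-bound₂ : (∀ {x} → NoUsefulOcc x u → NoUsefulOcc (suc (suc x)) t) →
                Avoids X u → Avoids (false ∷ false ∷ X) t
avoids-bound₂ f h = avoiding λ where
  zero ()
  (suc zero) ()
  (suc (suc x)) → f {x} ∘ avoids h x

⟦_⟧ : MTy n → Formula n
⟦ A ⁺ ⟧ = ⌜ A ⌝
⟦ A ⁻ ⟧ = ¬ₜ ⌜ A ⌝
⟦ A ⊕ ⟧ = ⌜ A ⌝
⟦ A ⊖ ⟧ = ¬ₜ ⌜ A ⌝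

⟦_⟧ᶜ : Ctx n → List Bool → FCtx n
⟦ [] ⟧ᶜ X = []
⟦ P ∷ Δ ⟧ᶜ [] = ⟦ P ⟧ ∷ ⟦ Δ ⟧ᶜ []
⟦ P ∷ Δ ⟧ᶜ (b ∷ X) = (if b then ⊤ₜ else ⟦ P ⟧) ∷ ⟦ Δ ⟧ᶜ X

⟦⟧-wkM : (P : MTy n) → ⟦ wkM P ⟧ ≡ wk ⟦ P ⟧
⟦⟧-wkM (A ⁺) = ⌜⌝-ren suc A
⟦⟧-wkM (A ⁻) = cong ¬ₜ_ (⌜⌝-ren suc A)
⟦⟧-wkM (A ⊕) = ⌜⌝-ren suc A
⟦⟧-wkM (A ⊖) = cong ¬ₜ_ (⌜⌝-ren suc A)

⟦⟧ᶜ-wkCtx : (Δ : Ctx n) (X : List Bool) → ⟦ wkCtx Δ ⟧ᶜ X ≡ map wk (⟦ Δ ⟧ᶜ X)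
⟦⟧ᶜ-wkCtx [] X = refl
⟦⟧ᶜ-wkCtx (P ∷ Δ) [] = cong₂ _∷_ (⟦⟧-wkM P) (⟦⟧ᶜ-wkCtx Δ [])
⟦⟧ᶜ-wkCtx (P ∷ Δ) (true ∷ X) = cong (⊤ₜ ∷_) (⟦⟧ᶜ-wkCtx Δ X)
⟦⟧ᶜ-wkCtx (P ∷ Δ) (false ∷ X) = cong₂ _∷_ (⟦⟧-wkM P) (⟦⟧ᶜ-wkCtx Δ X)

⟦⊕⟧ᶜ : (As : List (PureTy n)) → ⟦ map _⊕ As ⟧ᶜ [] ≡ map ⌜_⌝ As
⟦⊕⟧ᶜ [] = refl
⟦⊕⟧ᶜ (A ∷ As) = cong (⌜ A ⌝ ∷_) (⟦⊕⟧ᶜ As)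

∋⇒∈⟦⟧ᶜ : Δ ∋ k ∶ P → marked X k ≡ false → ⟦ P ⟧ ∈ ⟦ Δ ⟧ᶜ X
∋⇒∈⟦⟧ᶜ {X = []} here _ = here refl
∋⇒∈⟦⟧ᶜ {X = false ∷ X} here _ = here refl
∋⇒∈⟦⟧ᶜ {X = true ∷ X} here ()
∋⇒∈⟦⟧ᶜ {X = []} (there p) eq = there (∋⇒∈⟦⟧ᶜ p eq)
∋⇒∈⟦⟧ᶜ {X = b ∷ X} (there p) eq = there (∋⇒∈⟦⟧ᶜ p eq)

⟦⟧-sound : (X : List Bool) → Δ ⊢ t ∶ P → Intuitionistic t → Avoids X t → ⟦ Δ ⟧ᶜ X ⊢NJ ⟦ P ⟧
⟦⟧-sound X (ax {k = k} p) _ h with marked X k in eq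
... | true = ⊥-elim (avoids h k (subst T (sym eq) tt) refl)
... | false = axNJ (∋⇒∈⟦⟧ᶜ p eq)
⟦⟧-sound X (absR P d e) (i , j) h =
  contradictionNJ (⟦⟧-sound X e j (avoids-map proj₂ h)) (⟦⟧-sound X d i (avoids-map proj₁ h))
⟦⟧-sound X (lamw⁺ d) (i , z) h = discharge-⊤ₜ (⟦⟧-sound (true ∷ X) d i (avoids-under (const z) id h))
⟦⟧-sound X (lamw⁻ d) i h = ¬I-contract (⟦⟧-sound (false ∷ X) d i (avoids-bound id h))
⟦⟧-sound X (appw⁺ d _) i h = ⟦⟧-sound X d i (avoids-map id h)
⟦⟧-sound X (appw⁻ d _) (i , _) h = ⟦⟧-sound X d i (avoids-map proj₁ h)
⟦⟧-sound X (pair⁺ d e) (i , j) h = ∧I (⟦⟧-sound X d i (avoids-map proj₁ h)) (⟦⟧-sound X e j (avoids-map proj₂ h))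
⟦⟧-sound X (pair⁻ d e) (i , j) h = ¬∨I (⟦⟧-sound X d i (avoids-map proj₁ h)) (⟦⟧-sound X e j (avoids-map proj₂ h))
⟦⟧-sound X (proj⁺₁ d) i h = ∧E₁ (⟦⟧-sound X d i (avoids-map id h))
⟦⟧-sound X (proj⁺₂ d) i h = ∧E₂ (⟦⟧-sound X d i (avoids-map id h))
⟦⟧-sound X (proj⁻₁ d) i h = ¬∨E₁ (⟦⟧-sound X d i (avoids-map id h))
⟦⟧-sound X (proj⁻₂ d) i h = ¬∨E₂ (⟦⟧-sound X d i (avoids-map id h))
⟦⟧-sound X (inj⁺₁ d) i h = ∨I₁ (⟦⟧-sound X d i (avoids-map id h))
⟦⟧-sound X (inj⁺₂ d) i h = ∨I₂ (⟦⟧-sound X d i (avoids-map id h))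
⟦⟧-sound X (inj⁻₁ d) i h = ¬∧I₁ (⟦⟧-sound X d i (avoids-map id h))
⟦⟧-sound X (inj⁻₂ d) i h = ¬∧I₂ (⟦⟧-sound X d i (avoids-map id h))
⟦⟧-sound X (case⁺ d e f) (i , j , l) h =
  ∨E (⟦⟧-sound X d i (avoids-map proj₁ h))
     (⟦⟧-sound (false ∷ X) e j (avoids-bound (proj₁ ∘ proj₂) h))
     (⟦⟧-sound (false ∷ X) f l (avoids-bound (proj₂ ∘ proj₂) h))
⟦⟧-sound X (case⁻ _ _ _) () _
⟦⟧-sound X (lam⁺ d) i h = ⇒I (⟦⟧-sound (false ∷ X) d i (avoids-bound id h))
⟦⟧-sound X (lam⁻ d) i h = ¬⋉I (⟦⟧-sound (false ∷ X) d i (avoids-bound id h))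
⟦⟧-sound X (app⁺ d e) (i , j) h = ⇒E (⟦⟧-sound X d i (avoids-map proj₁ h)) (⟦⟧-sound X e j (avoids-map proj₂ h))
⟦⟧-sound X (app⁻ d e) (i , j) h = ¬⋉E (⟦⟧-sound X d i (avoids-map proj₁ h)) (⟦⟧-sound X e j (avoids-map proj₂ h))
⟦⟧-sound X (copair⁺ d e) (i , j) h = ⋉I (⟦⟧-sound X d i (avoids-map proj₁ h)) (⟦⟧-sound X e j (avoids-map proj₂ h))
⟦⟧-sound X (copair⁻ d e) (i , j) h = ¬⇒I (⟦⟧-sound X d i (avoids-map proj₁ h)) (⟦⟧-sound X e j (avoids-map proj₂ h))
⟦⟧-sound X (colam⁺ d e) (i , j) h =
  ⋉E (⟦⟧-sound X d i (avoids-map proj₁ h)) (⟦⟧-sound (false ∷ false ∷ X) e j (avoids-bound₂ proj₂ h))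
⟦⟧-sound X (colam⁻ _ _) () _
⟦⟧-sound X (negI⁺ d) i h = ⟦⟧-sound X d i (avoids-map id h)
⟦⟧-sound X (negI⁻ d) i h = ¬¬I (⟦⟧-sound X d i (avoids-map id h))
⟦⟧-sound X (negE⁺ d) i h = ⟦⟧-sound X d i (avoids-map id h)
⟦⟧-sound X (negE⁻ _) () _
⟦⟧-sound {Δ = Δ} X (tlam⁺ d) i h = ∀I (subst (_⊢NJ _) (⟦⟧ᶜ-wkCtx Δ X) (⟦⟧-sound X d i (avoids-map id h)))
⟦⟧-sound {Δ = Δ} X (tlam⁻ d) i h = ¬∃I (subst (_⊢NJ _) (⟦⟧ᶜ-wkCtx Δ X) (⟦⟧-sound X d i (avoids-map id h)))
⟦⟧-sound X (tapp⁺ {B = B} A d) i h =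
  subst (_ ⊢NJ_) (sym (⌜⌝-[] B A)) (∀E ⌜ A ⌝ (⟦⟧-sound X d i (avoids-map id h)))
⟦⟧-sound X (tapp⁻ {B = B} A d) i h =
  subst (λ F → _ ⊢NJ ¬ₜ F) (sym (⌜⌝-[] B A)) (¬∃E ⌜ A ⌝ (⟦⟧-sound X d i (avoids-map id h)))
⟦⟧-sound X (pack⁺ {B = B} A d) i h =
  ∃I ⌜ A ⌝ (subst (_ ⊢NJ_) (⌜⌝-[] B A) (⟦⟧-sound X d i (avoids-map id h)))
⟦⟧-sound X (pack⁻ {B = B} A d) i h =
  ¬∀I ⌜ A ⌝ (subst (λ F → _ ⊢NJ ¬ₜ F) (⌜⌝-[] B A) (⟦⟧-sound X d i (avoids-map id h)))
⟦⟧-sound {Δ = Δ} X (open⁺ {A = A} {P = P} d e) (i , j) h =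
  ∃E (⟦⟧-sound X d i (avoids-map proj₁ h))
     (subst₂ _⊢NJ_ (cong (⌜ A ⌝ ∷_) (⟦⟧ᶜ-wkCtx Δ X)) (⟦⟧-wkM P)
        (⟦⟧-sound (false ∷ X) e j (avoids-bound proj₂ h)))
⟦⟧-sound X (open⁻ _ _) () _

-- Completeness

-- Intuitionistic typing in which the variables marked in F, the continuations bound by
-- enclosing λ⁺∘, have no useful occurrence.
infix 4 _⊢[_]_∶_
_⊢[_]_∶_ : Ctx n → List Bool → Tm n → MTy n → Set
Δ ⊢[ F ] t ∶ P = Δ ⊢ t ∶ P × Intuitionistic t × Avoids F t

typing : Δ ⊢[ F ] t ∶ P → Δ ⊢ t ∶ P
typing = proj₁

avoids-pair : Avoids F t → Avoids F s → ∀ x → T (marked F x) → NoUsefulOcc x t × NoUsefulOcc x s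
avoids-pair h h′ x m = avoids h x m , avoids h′ x m

clash : Tm n → Tm n → MTy n → Tm n
clash a u P = abs (appw pos u a) (appw neg a u) P

clash⊢ : Δ ⊢ a ∶ A ⊖ → Δ ⊢ u ∶ A ⊕ → Δ ⊢ clash a u P ∶ P
clash⊢ a u = absR _ (appw⁺ u a) (appw⁻ a u)

tollens : Δ ∋ k ∶ (C ⊖) → ((A ⊕) ∷ Δ) ⊢ u ∶ C ⊕ → Δ ⊢ lamw neg (A ⊕) (clash (var (suc k)) u (A ⁻)) ∶ A ⊖
tollens k u = lamw⁻ (clash⊢ (ax (there k)) u)

refute-⊥ₚ : Tm n
refute-⊥ₚ = lamw neg (⊥ₚ ⊕) (pack neg (¬ₜ ⊥ₚ) (lamw neg ((¬ₜ ⊥ₚ) ⊕) (negI neg (var 1))))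

-- ∀α.α is refuted by instantiating α with ¬(∀α.α), which it refutes itself.
refute-⊥ₚ⊢ : Δ ⊢ refute-⊥ₚ ∶ ⊥ₚ ⊖
refute-⊥ₚ⊢ = lamw⁻ (pack⁻ (¬ₜ ⊥ₚ) (lamw⁻ (negI⁻ (ax (there here)))))

varᵢ : Δ ∋ k ∶ P → marked F k ≡ false → Δ ⊢[ F ] var k ∶ P
varᵢ p eq = ax p , tt , avoiding λ x m → λ { refl → subst T eq m }

lamw⁺ᵢ : ((A ⊖) ∷ Δ) ⊢[ true ∷ F ] t ∶ A ⁺ → Δ ⊢[ F ] lamw pos (A ⊖) t ∶ A ⊕
lamw⁺ᵢ (d , i , h) = lamw⁺ d , (i , avoids h zero tt) , avoiding (avoids h ∘ suc)

lamw⁻ᵢ : ((A ⊕) ∷ Δ) ⊢[ false ∷ F ] t ∶ A ⁻ → Δ ⊢[ F ] lamw neg (A ⊕) t ∶ A ⊖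
lamw⁻ᵢ (d , i , h) = lamw⁻ d , i , avoiding (avoids h ∘ suc)

appw⁺ᵢ : Δ ⊢[ F ] t ∶ A ⊕ → Δ ⊢ s ∶ A ⊖ → Δ ⊢[ F ] appw pos t s ∶ A ⁺
appw⁺ᵢ (d , i , h) e = appw⁺ d e , i , avoiding (avoids h)

clashᵢ : Δ ⊢[ F ] a ∶ A ⊖ → Δ ⊢[ F ] u ∶ A ⊕ → Δ ⊢[ F ] clash a u P ∶ P
clashᵢ (d , i , h) (d′ , i′ , h′) =
  clash⊢ d d′ , (i′ , i , i′) , avoiding λ x m → avoids h′ x m , avoids-pair h h′ x m

pair⁺ᵢ : Δ ⊢[ F ] t ∶ A ⊕ → Δ ⊢[ F ] s ∶ B ⊕ → Δ ⊢[ F ] pair pos t s ∶ (A ∧ₜ B) ⁺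
pair⁺ᵢ (d , i , h) (d′ , i′ , h′) = pair⁺ d d′ , (i , i′) , avoiding (avoids-pair h h′)

proj⁺₁ᵢ : Δ ⊢[ F ] t ∶ (A ∧ₜ B) ⁺ → Δ ⊢[ F ] proj pos ₁ t ∶ A ⊕
proj⁺₁ᵢ (d , i , h) = proj⁺₁ d , i , avoiding (avoids h)

proj⁺₂ᵢ : Δ ⊢[ F ] t ∶ (A ∧ₜ B) ⁺ → Δ ⊢[ F ] proj pos ₂ t ∶ B ⊕
proj⁺₂ᵢ (d , i , h) = proj⁺₂ d , i , avoiding (avoids h)

inj⁺₁ᵢ : Δ ⊢[ F ] t ∶ A ⊕ → Δ ⊢[ F ] inj pos ₁ t ∶ (A ∨ₜ B) ⁺
inj⁺₁ᵢ (d , i , h) = inj⁺₁ d , i , avoiding (avoids h)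

inj⁺₂ᵢ : Δ ⊢[ F ] t ∶ B ⊕ → Δ ⊢[ F ] inj pos ₂ t ∶ (A ∨ₜ B) ⁺
inj⁺₂ᵢ (d , i , h) = inj⁺₂ d , i , avoiding (avoids h)

case⁺ᵢ : Δ ⊢[ F ] t ∶ (A ∨ₜ B) ⁺ →
         ((A ⊕) ∷ Δ) ⊢[ false ∷ F ] s ∶ P → ((B ⊕) ∷ Δ) ⊢[ false ∷ F ] u ∶ P →
         Δ ⊢[ F ] case pos t (A ⊕) s (B ⊕) u ∶ P
case⁺ᵢ (d , i , h) (d′ , i′ , h′) (d″ , i″ , h″) =
  case⁺ d d′ d″ , (i , i′ , i″) ,
  avoiding λ x m → avoids h x m , avoids h′ (suc x) m , avoids h″ (suc x) m

lam⁺ᵢ : ((A ⊕) ∷ Δ) ⊢[ false ∷ F ] t ∶ B ⊕ → Δ ⊢[ F ] lam pos (A ⊕) t ∶ (A ⇒ₜ B) ⁺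
lam⁺ᵢ (d , i , h) = lam⁺ d , i , avoiding (avoids h ∘ suc)

app⁺ᵢ : Δ ⊢[ F ] t ∶ (A ⇒ₜ B) ⁺ → Δ ⊢[ F ] s ∶ A ⊕ → Δ ⊢[ F ] app pos t s ∶ B ⊕
app⁺ᵢ (d , i , h) (d′ , i′ , h′) = app⁺ d d′ , (i , i′) , avoiding (avoids-pair h h′)

copair⁺ᵢ : Δ ⊢[ F ] t ∶ A ⊖ → Δ ⊢[ F ] s ∶ B ⊕ → Δ ⊢[ F ] copair pos t s ∶ (A ⋉ₜ B) ⁺
copair⁺ᵢ (d , i , h) (d′ , i′ , h′) = copair⁺ d d′ , (i , i′) , avoiding (avoids-pair h h′)

colam⁺ᵢ : Δ ⊢[ F ] t ∶ (A ⋉ₜ B) ⁺ → ((B ⊕) ∷ (A ⊖) ∷ Δ) ⊢[ false ∷ false ∷ F ] s ∶ P →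
          Δ ⊢[ F ] colam pos t (A ⊖) (B ⊕) s ∶ P
colam⁺ᵢ (d , i , h) (d′ , i′ , h′) =
  colam⁺ d d′ , (i , i′) , avoiding λ x m → avoids h x m , avoids h′ (suc (suc x)) m

negI⁺ᵢ : Δ ⊢[ F ] t ∶ A ⊖ → Δ ⊢[ F ] negI pos t ∶ (¬ₜ A) ⁺
negI⁺ᵢ (d , i , h) = negI⁺ d , i , avoiding (avoids h)

negE⁺ᵢ : Δ ⊢[ F ] t ∶ (¬ₜ A) ⁺ → Δ ⊢[ F ] negE pos t ∶ A ⊖
negE⁺ᵢ (d , i , h) = negE⁺ d , i , avoiding (avoids h)

tlam⁺ᵢ : wkCtx Δ ⊢[ F ] t ∶ A ⊕ → Δ ⊢[ F ] tlam pos t ∶ (∀ₜ A) ⁺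
tlam⁺ᵢ (d , i , h) = tlam⁺ d , i , avoiding (avoids h)

tapp⁺ᵢ : (A : PureTy n) → Δ ⊢[ F ] t ∶ (∀ₜ B) ⁺ → Δ ⊢[ F ] tapp pos t A ∶ (B [ A ]) ⊕
tapp⁺ᵢ A (d , i , h) = tapp⁺ A d , i , avoiding (avoids h)

pack⁺ᵢ : (A : PureTy n) → Δ ⊢[ F ] t ∶ (B [ A ]) ⊕ → Δ ⊢[ F ] pack pos A t ∶ (∃ₜ B) ⁺
pack⁺ᵢ A (d , i , h) = pack⁺ A d , i , avoiding (avoids h)

open⁺ᵢ : Δ ⊢[ F ] t ∶ (∃ₜ A) ⁺ → ((A ⊕) ∷ wkCtx Δ) ⊢[ false ∷ F ] s ∶ wkM P →
         Δ ⊢[ F ] open' pos t (A ⊕) s ∶ P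
open⁺ᵢ (d , i , h) (d′ , i′ , h′) =
  open⁺ d d′ , (i , i′) , avoiding λ x m → avoids h x m , avoids h′ (suc x) m

⊢[]-retype : A ≡ B → Δ ⊢[ F ] t ∶ A ⊕ → Δ ⊢[ F ] t ∶ B ⊕
⊢[]-retype refl d = d

capture : ((A ⊖) ∷ Δ) ⊢[ true ∷ F ] t ∶ A ⊕ → Δ ⊢[ F ] lamw pos (A ⊖) (appw pos t (var 0)) ∶ A ⊕
capture d = lamw⁺ᵢ (appw⁺ᵢ d (ax here))

letᵢ : Δ ⊢[ F ] s ∶ A ⊕ → ((A ⊕) ∷ Δ) ⊢[ false ∷ F ] t ∶ C ⊕ → Δ ⊢[ F ] app pos (lam pos (A ⊕) t) s ∶ C ⊕
letᵢ s t = app⁺ᵢ (lam⁺ᵢ t) s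

exFalsoᵢ : (C : PureTy n) → Δ ⊢[ F ] t ∶ ⊥ₚ ⊕ → Δ ⊢[ F ] tapp pos (appw pos t refute-⊥ₚ) C ∶ C ⊕
exFalsoᵢ C d = tapp⁺ᵢ C (appw⁺ᵢ d refute-⊥ₚ⊢)

record Env (Γ : FCtx n) (Δ : Ctx n) : Set where
  field
    forbidden    : List Bool
    slot         : φ ∈ Γ → ℕ
    slot-typed   : (p : φ ∈ Γ) → Δ ∋ slot p ∶ (⌞ φ ⌟ ⊕)
    slot-allowed : (p : φ ∈ Γ) → marked forbidden (slot p) ≡ false
open Env

forbid : Env Γ Δ → Env Γ (P ∷ Δ)
forbid E .forbidden = true ∷ forbidden E
forbid E .slot p = suc (slot E p)
forbid E .slot-typed p = there (slot-typed E p)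
forbid E .slot-allowed p = slot-allowed E p

skip : Env Γ Δ → Env Γ (P ∷ Δ)
skip E .forbidden = false ∷ forbidden E
skip E .slot p = suc (slot E p)
skip E .slot-typed p = there (slot-typed E p)
skip E .slot-allowed p = slot-allowed E p

bind : Env Γ Δ → Env (φ ∷ Γ) ((⌞ φ ⌟ ⊕) ∷ Δ)
bind E .forbidden = false ∷ forbidden E
bind E .slot (here _) = zero
bind E .slot (there p) = suc (slot E p)
bind E .slot-typed (here refl) = here
bind E .slot-typed (there p) = there (slot-typed E p)
bind E .slot-allowed (here _) = refl
bind E .slot-allowed (there p) = slot-allowed E p

∋-wkCtx : Δ ∋ k ∶ P → wkCtx Δ ∋ k ∶ wkM P
∋-wkCtx here = here
∋-wkCtx (there p) = there (∋-wkCtx p)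

wkEnv : Env Γ Δ → Env (map wk Γ) (wkCtx Δ)
wkEnv E .forbidden = forbidden E
wkEnv E .slot p = slot E (proj₁ (proj₂ (∈-map⁻ wk p)))
wkEnv {Δ = Δ} E .slot-typed p with ∈-map⁻ wk p
... | φ , q , refl =
  subst (λ A → wkCtx Δ ∋ slot E q ∶ (A ⊕)) (sym (⌞⌟-ren suc φ)) (∋-wkCtx (slot-typed E q))
wkEnv E .slot-allowed p = slot-allowed E (proj₁ (proj₂ (∈-map⁻ wk p)))

hypotheses : (As : List (PureTy n)) → Env (map ⌜_⌝ As) (map _⊕ As)
hypotheses As .forbidden = []
hypotheses As .slot p = toℕ (index p)
hypotheses As .slot-typed = typed As
  where
  typed : (As : List (PureTy n)) (p : φ ∈ map ⌜_⌝ As) → map _⊕ As ∋ toℕ (index p) ∶ (⌞ φ ⌟ ⊕)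
  typed (A ∷ As) (here refl) = subst (λ B → (A ⊕ ∷ map _⊕ As) ∋ 0 ∶ (B ⊕)) (sym (⌞⌜⌝⌟ A)) here
  typed (A ∷ As) (there p) = there (typed As p)
hypotheses As .slot-allowed p = refl

-- Realisers work in every environment, so that they can be re-used under further binders,
-- and in useless positions, where only their typing matters.
infix 4 _⊩_
record _⊩_ (Γ : FCtx n) (φ : Formula n) : Set where
  field run : (E : Env Γ Δ) → Σ (Tm n) λ t → Δ ⊢[ forbidden E ] t ∶ ⌞ φ ⌟ ⊕
open _⊩_

infixl 5 _at_
_at_ : (r : Γ ⊩ φ) (E : Env Γ Δ) → Δ ⊢[ forbidden E ] proj₁ (run r E) ∶ ⌞ φ ⌟ ⊕
r at E = proj₂ (run r E)

⊩-ax : φ ∈ Γ → Γ ⊩ φ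
⊩-ax p .run E = -, varᵢ (slot-typed E p) (slot-allowed E p)

⊩-⊥E : Γ ⊩ botₜ → Γ ⊩ χ
⊩-⊥E {χ = χ} r .run E = -, exFalsoᵢ ⌞ χ ⌟ (r at E)

⊩-∧I : Γ ⊩ φ → Γ ⊩ ψ → Γ ⊩ φ ∧ₜ ψ
⊩-∧I r r′ .run E = -, lamw⁺ᵢ (pair⁺ᵢ (r at forbid E) (r′ at forbid E))

⊩-∧E₁ : Γ ⊩ φ ∧ₜ ψ → Γ ⊩ φ
⊩-∧E₁ r .run E = -, capture (proj⁺₁ᵢ (appw⁺ᵢ (r at forbid E) (lamw⁻ (inj⁻₁ (ax (there here))))))

⊩-∧E₂ : Γ ⊩ φ ∧ₜ ψ → Γ ⊩ ψ
⊩-∧E₂ r .run E = -, capture (proj⁺₂ᵢ (appw⁺ᵢ (r at forbid E) (lamw⁻ (inj⁻₂ (ax (there here))))))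

⊩-∨I₁ : Γ ⊩ φ → Γ ⊩ φ ∨ₜ ψ
⊩-∨I₁ r .run E = -, lamw⁺ᵢ (inj⁺₁ᵢ (r at forbid E))

⊩-∨I₂ : Γ ⊩ ψ → Γ ⊩ φ ∨ₜ ψ
⊩-∨I₂ r .run E = -, lamw⁺ᵢ (inj⁺₂ᵢ (r at forbid E))

⊩-∨E : Γ ⊩ φ ∨ₜ ψ → (φ ∷ Γ) ⊩ χ → (ψ ∷ Γ) ⊩ χ → Γ ⊩ χ
⊩-∨E r r₁ r₂ .run E =
  -, capture (case⁺ᵢ (appw⁺ᵢ (r at forbid E) refutation) (r₁ at bind (forbid E)) (r₂ at bind (forbid E)))
  where
  refutation = lamw⁻ (pair⁻ (tollens (there here) (typing (r₁ at bind (skip (forbid E)))))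
                             (tollens (there here) (typing (r₂ at bind (skip (forbid E))))))

⊩-⇒I : (φ ∷ Γ) ⊩ ψ → Γ ⊩ φ ⇒ₜ ψ
⊩-⇒I r .run E = -, lamw⁺ᵢ (lam⁺ᵢ (r at bind (forbid E)))

⊩-⇒E : Γ ⊩ φ ⇒ₜ ψ → Γ ⊩ φ → Γ ⊩ ψ
⊩-⇒E r r′ .run E =
  -, capture (app⁺ᵢ (appw⁺ᵢ (r at forbid E) (lamw⁻ (copair⁻ (typing (r′ at skip (forbid E))) (ax (there here)))))
                    (r′ at forbid E))

⊩-¬I : (φ ∷ Γ) ⊩ botₜ → Γ ⊩ ¬ₜ φ
⊩-¬I {φ = φ} r .run E = -, lamw⁺ᵢ (negI⁺ᵢ (lamw⁻ᵢ (clashᵢ refuted (varᵢ here refl))))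
  where
  refuted = negE⁺ᵢ (appw⁺ᵢ (exFalsoᵢ (¬ₜ ⌞ φ ⌟) (r at bind (forbid E))) (lamw⁻ (negI⁻ (ax (there here)))))

⊩-¬E : Γ ⊩ ¬ₜ φ → Γ ⊩ φ → Γ ⊩ botₜ
⊩-¬E r r′ .run E = -, clashᵢ (negE⁺ᵢ (appw⁺ᵢ (r at E) (lamw⁻ (negI⁻ (typing (r′ at skip E)))))) (r′ at E)

⊩-⋉I : Γ ⊩ ¬ₜ φ → Γ ⊩ ψ → Γ ⊩ φ ⋉ₜ ψ
⊩-⋉I r r′ .run E = -, lamw⁺ᵢ (copair⁺ᵢ (negE⁺ᵢ (appw⁺ᵢ (r at forbid E) refutation)) (r′ at forbid E))
  where
  refutation = lamw⁻ (negI⁻ (lamw⁺ (clash⊢ (ax (there (there here)))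
                 (lamw⁺ (copair⁺ (ax (there here)) (typing (r′ at skip (skip (skip (forbid E))))))))))

⊩-⋉E : Γ ⊩ φ ⋉ₜ ψ → (ψ ∷ ¬ₜ φ ∷ Γ) ⊩ χ → Γ ⊩ χ
⊩-⋉E {Γ = Γ} {φ = φ} {ψ = ψ} {χ = χ} r r′ .run E =
  -, capture (colam⁺ᵢ (appw⁺ᵢ (r at forbid E) refutation) (proj₂ (premises (forbid E))))
  where
  -- The hypotheses ψ and ¬φ of the premiss are passed by β-redexes, built from the
  -- variables of types ψ⊕ and φ⊖ bound by colam.
  premises : (E′ : Env Γ Δ′) →
             Σ (Tm _) λ t → ((⌞ ψ ⌟ ⊕) ∷ (⌞ φ ⌟ ⊖) ∷ Δ′) ⊢[ false ∷ false ∷ forbidden E′ ] t ∶ ⌞ χ ⌟ ⊕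
  premises E′ = -, letᵢ (lamw⁺ᵢ (negI⁺ᵢ (varᵢ (there (there here)) refl)))
                        (letᵢ (varᵢ (there here) refl) (r′ at bind (bind (skip (skip E′)))))
  refutation = lamw⁻ (lam⁻ (tollens (there (there here)) (typing (proj₂ (premises (skip (forbid E)))))))

⊩-∀I : map wk Γ ⊩ φ → Γ ⊩ ∀ₜ φ
⊩-∀I r .run E = -, lamw⁺ᵢ (tlam⁺ᵢ (r at wkEnv (forbid E)))

⊩-∀E : (φ : Formula n) → Γ ⊩ ∀ₜ ψ → Γ ⊩ ψ [ φ ]
⊩-∀E {ψ = ψ} φ r .run E =
  -, ⊢[]-retype (sym (⌞⌟-[] ψ φ))
       (capture (tapp⁺ᵢ ⌞ φ ⌟ (appw⁺ᵢ (r at forbid E) (lamw⁻ (pack⁻ ⌞ φ ⌟ (ax (there here)))))))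

⊩-∃I : (φ : Formula n) → Γ ⊩ ψ [ φ ] → Γ ⊩ ∃ₜ ψ
⊩-∃I {ψ = ψ} φ r .run E = -, lamw⁺ᵢ (pack⁺ᵢ ⌞ φ ⌟ (⊢[]-retype (⌞⌟-[] ψ φ) (r at forbid E)))

⊩-∃E : Γ ⊩ ∃ₜ φ → (φ ∷ map wk Γ) ⊩ wk χ → Γ ⊩ χ
⊩-∃E {Γ = Γ} {φ = φ} {χ = χ} r r′ .run E =
  -, capture (open⁺ᵢ (appw⁺ᵢ (r at forbid E) refutation) (opened (forbid E)))
  where
  opened : (E′ : Env Γ Δ′) →
           ((⌞ φ ⌟ ⊕) ∷ wkCtx Δ′) ⊢[ false ∷ forbidden E′ ] proj₁ (run r′ (bind (wkEnv E′))) ∶ wk ⌞ χ ⌟ ⊕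
  opened E′ = ⊢[]-retype (⌞⌟-ren suc χ) (r′ at bind (wkEnv E′))
  refutation = lamw⁻ (tlam⁻ (tollens (there here) (typing (opened (skip (forbid E))))))

realise : Γ ⊢NJ φ → Γ ⊩ φ
realise (axNJ p) = ⊩-ax p
realise (⊥E d) = ⊩-⊥E (realise d)
realise (∧I d e) = ⊩-∧I (realise d) (realise e)
realise (∧E₁ d) = ⊩-∧E₁ (realise d)
realise (∧E₂ d) = ⊩-∧E₂ (realise d)
realise (∨I₁ d) = ⊩-∨I₁ (realise d)
realise (∨I₂ d) = ⊩-∨I₂ (realise d)
realise (∨E d e f) = ⊩-∨E (realise d) (realise e) (realise f)
realise (⇒I d) = ⊩-⇒I (realise d)
realise (⇒E d e) = ⊩-⇒E (realise d) (realise e)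
realise (¬I d) = ⊩-¬I (realise d)
realise (¬E d e) = ⊩-¬E (realise d) (realise e)
realise (⋉I d e) = ⊩-⋉I (realise d) (realise e)
realise (⋉E d e) = ⊩-⋉E (realise d) (realise e)
realise (∀I d) = ⊩-∀I (realise d)
realise (∀E φ d) = ⊩-∀E φ (realise d)
realise (∃I φ d) = ⊩-∃I φ (realise d)
realise (∃E d e) = ⊩-∃E (realise d) (realise e)

PRJ⇒NJ : (As : List (PureTy n)) → map _⊕ As ⊢PRJ t ∶ B ⊕ → map ⌜_⌝ As ⊢NJ ⌜ B ⌝
PRJ⇒NJ {B = B} As (d , i) = subst (_⊢NJ ⌜ B ⌝) (⟦⊕⟧ᶜ As) (⟦⟧-sound [] d i (avoiding λ _ ()))

NJ⇒PRJ : (As : List (PureTy n)) → map ⌜_⌝ As ⊢NJ ⌜ B ⌝ → Σ (Tm n) λ t → map _⊕ As ⊢PRJ t ∶ B ⊕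
NJ⇒PRJ {B = B} As d =
  let d′ , i , _ = ⊢[]-retype (⌞⌜⌝⌟ B) (realise d at hypotheses As) in -, d′ , i

theorem9 : ∀ {n : ℕ} (As : List (PureTy n)) (B : PureTy n) →
    (Σ (Tm n) (λ t → map _⊕ As ⊢PRJ t ∶ B ⊕)) ⇔ (map ⌜_⌝ As ⊢NJ ⌜ B ⌝)
theorem9 As B = mk⇔ (PRJ⇒NJ As ∘ proj₂) (NJ⇒PRJ As)
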